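{- Let $G$ be a properly edge-coloured graph with $n$ vertices and at least $nd$ edges, and let $k$ be an integer with $1\leq k<d/8$. Then $G$ contains at least $n(d/4)^{k}$ labelled rainbow paths of length $k$.
   Context: A labelled path of length $k$ is a sequence of distinct vertices $v_0,v_1,\dots,v_k$ with $v_iv_{i+1}\in E(G)$ for all $i$; it is rainbow if its $k$ edges have distinct colours. A proper edge-colouring assigns different colours to edges sharing a vertex.
   Formalization: The parameter d is taken to be rational. -}

module Defs where

open import Data.Bool using (Bool; true; false; _∧_; not; T)
open import Data.Nat as ℕ using (ℕ; zero; suc)
open import Data.Fin using (Fin; toℕ)
import Data.Fin as Fin
open import Data.List using (List; []; _∷_; length; filter; map; concatMap; allFin; cartesianProduct)
open import Data.Vec as Vec using (Vec)
open import Data.Product using (_×_; _,_; proj₁; proj₂)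
open import Relation.Nullary using (¬_)
open import Relation.Nullary.Decidable using (⌊_⌋)
open import Relation.Binary.PropositionalEquality using (_≡_; _≢_)
open import Data.Integer using (+_)
open import Data.Rational as ℚ using (ℚ; 1ℚ; _*_; _/_)

record Graph (n : ℕ) : Set where
  field
    adj       : Fin n → Fin n → Bool
    adj-sym   : ∀ u v → adj u v ≡ adj v u
    adj-irref : ∀ v → adj v v ≡ false

open Graph public

-- An edge colouring (colours are natural numbers): a colour assigned to
-- every ordered pair, symmetric on edges; only values on edges matter.
EdgeColouring : ∀ {n} → Graph n → Set
EdgeColouring {n} G = Fin n → Fin n → ℕ

SymmetricColouring : ∀ {n} (G : Graph n) → EdgeColouring G → Set
SymmetricColouring {n} G c = ∀ (u v : Fin n) → T (adj G u v) → c u v ≡ c v u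

Proper : ∀ {n} (G : Graph n) → EdgeColouring G → Set
Proper {n} G c = ∀ (u v w : Fin n) → T (adj G u v) → T (adj G u w) → v ≢ w → c u v ≢ c u w

edgeCount : ∀ {n} → Graph n → ℕ
edgeCount {n} G =
  length (filter (λ p → ℕ._<?_ (toℕ (proj₁ p)) (toℕ (proj₂ p)))
    (filter (λ p → Data.Bool._≟_ (adj G (proj₁ p) (proj₂ p)) true)
      (cartesianProduct (allFin n) (allFin n))))
  where import Data.Bool

allVecs : (n m : ℕ) → List (Vec (Fin n) m)
allVecs n zero = Vec.[] ∷ []
allVecs n (suc m) = concatMap (λ v → map (λ xs → v Vec.∷ xs) (allVecs n m)) (allFin n)

allDistinct : {A : Set} → (A → A → Bool) → List A → Bool
allDistinct eq [] = true
allDistinct eq (x ∷ xs) = allB (λ y → not (eq x y)) xs ∧ allDistinct eq xs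
  where
  allB : {A : Set} → (A → Bool) → List A → Bool
  allB f [] = true
  allB f (y ∷ ys) = f y ∧ allB f ys

consecutive : {A : Set} → List A → List (A × A)
consecutive [] = []
consecutive (x ∷ []) = []
consecutive (x ∷ y ∷ ys) = (x , y) ∷ consecutive (y ∷ ys)

allEdges : ∀ {n} → Graph n → List (Fin n × Fin n) → Bool
allEdges G [] = true
allEdges G ((u , v) ∷ es) = adj G u v ∧ allEdges G es

isRainbowPath : ∀ {n k} (G : Graph n) → EdgeColouring G → Vec (Fin n) (suc k) → Bool
isRainbowPath G c vs =
  allDistinct (λ a b → ⌊ a Fin.≟ b ⌋) (Vec.toList vs)
  ∧ allEdges G (consecutive (Vec.toList vs))
  ∧ allDistinct (λ a b → ⌊ a ℕ.≟ b ⌋) (map (λ e → c (proj₁ e) (proj₂ e)) (consecutive (Vec.toList vs)))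

rainbowPathCount : ∀ {n} (G : Graph n) → EdgeColouring G → ℕ → ℕ
rainbowPathCount {n} G c k =
  length (filter (λ vs → Data.Bool._≟_ (isRainbowPath G c vs) true) (allVecs n (suc k)))
  where import Data.Bool

_^ℚ_ : ℚ → ℕ → ℚ
q ^ℚ zero = 1ℚ
q ^ℚ suc m = q * (q ^ℚ m)

⟦_⟧ : ℕ → ℚ
⟦ m ⟧ = + m / 1

module Submission where

-- Write d = p/q and s = ⌊d/2⌋. Deleting vertices of degree at most s one at a time lowers the
-- degree sum 2e(G) ≥ 2nd by at most 2s ≤ d per deletion, so the surviving subgraph H has degree
-- sum h ≥ nd and minimum degree > s. A rainbow path of H with j edges ending at w extends at w
-- in at least deg(w) − 2j ways: the new vertex must avoid the other j vertices of the path, and,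
-- the colouring being proper, each of the j colours already used excludes at most one neighbour
-- of w. Starting from the h oriented edges of H this yields at least h(s + 1 − 2k)^(k−1) rainbow
-- paths of length k, which is at least n(d/4)^k because s + 1 − 2k > d/2 − d/4 when k < d/8.

open import Defs

module Counting where

  import Algebra.Properties.CommutativeSemigroup as CommutativeSemigroupProperties
  open import Data.Bool using (Bool; true; false; _∧_; not; T)
  open import Data.Bool.Properties using (T?; T-∧)
  open import Data.Bool.ListAction using (all)
  import Data.Bool as Bool
  open import Data.Nat as ℕ using (ℕ; zero; suc; _+_; _*_; _∸_; _^_; _≤_; _<_; z≤n; s≤s; s≤s⁻¹; _≤?_; NonZero; _/_; _%_)
  open import Data.Nat.Properties hiding (_≟_)
  open import Data.Nat.DivMod using (m/n*n≤m; m≡m%n+[m/n]*n; m%n<n)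
  open import Data.Nat.Tactic.RingSolver using (solve-∀)
  open import Data.Fin using (Fin; _≟_; toℕ)
  import Data.Fin as Fin
  import Data.Fin.Properties as Finₚ
  open import Data.List using (List; []; _∷_; length; filter; map; concatMap; allFin; cartesianProduct; _++_)
  open import Data.List.Properties using (map-tabulate; length-tabulate; length-map)
  open import Data.Vec as Vec using (Vec; toList)
  open import Data.Vec.Properties using (length-toList)
  open import Data.Product using (_×_; _,_; proj₁; proj₂; ∃-syntax)
  open import Data.Unit using (tt)
  open import Data.Empty using (⊥-elim)
  open import Function using (_∘_)
  open import Function.Bundles using (Equivalence)
  open import Level using (Level)
  open import Relation.Nullary using (Dec; yes; no; does)
  open import Relation.Nullary.Decidable using (⌊_⌋; _×-dec_; toWitness)
  open import Relation.Unary using (Pred; Decidable)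
  open import Relation.Binary.PropositionalEquality

  open Equivalence using (to; from)
  open CommutativeSemigroupProperties +-commutativeSemigroup using () renaming (interchange to +-interchange)
  open CommutativeSemigroupProperties *-commutativeSemigroup using () renaming (interchange to *-interchange)

  private
    variable
      A B : Set

  𝟙 : Bool → ℕ
  𝟙 true = 1
  𝟙 false = 0

  𝟙-∧ : ∀ a b → 𝟙 (a ∧ b) ≡ 𝟙 a * 𝟙 b
  𝟙-∧ true b = sym (+-identityʳ (𝟙 b))
  𝟙-∧ false b = refl

  ∑ : List A → (A → ℕ) → ℕ
  ∑ [] f = 0
  ∑ (x ∷ xs) f = f x + ∑ xs f

  syntax ∑ xs (λ x → e) = ∑[ x ← xs ] e

  ∑-cong : (xs : List A) {f g : A → ℕ} → (∀ x → f x ≡ g x) → ∑ xs f ≡ ∑ xs g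
  ∑-cong [] eq = refl
  ∑-cong (x ∷ xs) eq = cong₂ _+_ (eq x) (∑-cong xs eq)

  ∑-mono-≤ : (xs : List A) {f g : A → ℕ} → (∀ x → f x ≤ g x) → ∑ xs f ≤ ∑ xs g
  ∑-mono-≤ [] le = z≤n
  ∑-mono-≤ (x ∷ xs) le = +-mono-≤ (le x) (∑-mono-≤ xs le)

  ∑-zero : (xs : List A) {f : A → ℕ} → (∀ x → f x ≡ 0) → ∑ xs f ≡ 0
  ∑-zero [] z = refl
  ∑-zero (x ∷ xs) z = cong₂ _+_ (z x) (∑-zero xs z)

  ∑-+ : (xs : List A) (f g : A → ℕ) → ∑[ x ← xs ] (f x + g x) ≡ ∑ xs f + ∑ xs g
  ∑-+ [] f g = refl
  ∑-+ (x ∷ xs) f g rewrite ∑-+ xs f g = +-interchange (f x) (g x) (∑ xs f) (∑ xs g)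

  ∑-*ˡ : (xs : List A) (c : ℕ) (f : A → ℕ) → ∑[ x ← xs ] (c * f x) ≡ c * ∑ xs f
  ∑-*ˡ [] c f = sym (*-zeroʳ c)
  ∑-*ˡ (x ∷ xs) c f rewrite ∑-*ˡ xs c f = sym (*-distribˡ-+ c (f x) _)

  ∑-*ʳ : (xs : List A) (c : ℕ) (f : A → ℕ) → ∑[ x ← xs ] (f x * c) ≡ ∑ xs f * c
  ∑-*ʳ xs c f = trans (∑-cong xs (λ x → *-comm (f x) c)) (trans (∑-*ˡ xs c f) (*-comm c _))

  ∑-const-1 : (xs : List A) → ∑[ _ ← xs ] 1 ≡ length xs
  ∑-const-1 [] = refl
  ∑-const-1 (x ∷ xs) = cong suc (∑-const-1 xs)

  ∑-≤-length : (xs : List A) {f : A → ℕ} → (∀ x → f x ≤ 1) → ∑ xs f ≤ length xs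
  ∑-≤-length xs le = ≤-trans (∑-mono-≤ xs le) (≤-reflexive (∑-const-1 xs))

  ∑-++ : (xs ys : List A) (f : A → ℕ) → ∑ (xs ++ ys) f ≡ ∑ xs f + ∑ ys f
  ∑-++ [] ys f = refl
  ∑-++ (x ∷ xs) ys f rewrite ∑-++ xs ys f = sym (+-assoc (f x) _ _)

  ∑-filter : {ℓ : Level} {P : Pred A ℓ} (P? : Decidable P) (xs : List A) (f : A → ℕ) →
             ∑ (filter P? xs) f ≡ ∑[ x ← xs ] (𝟙 (does (P? x)) * f x)
  ∑-filter P? [] f = refl
  ∑-filter P? (x ∷ xs) f with does (P? x)
  ... | true = cong₂ _+_ (sym (+-identityʳ (f x))) (∑-filter P? xs f)
  ... | false = ∑-filter P? xs f

  length-filter : {ℓ : Level} {P : Pred A ℓ} (P? : Decidable P) (xs : List A) →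
                  length (filter P? xs) ≡ ∑[ x ← xs ] 𝟙 (does (P? x))
  length-filter P? xs = trans (sym (∑-const-1 (filter P? xs)))
    (trans (∑-filter P? xs (λ _ → 1)) (∑-cong xs (λ x → *-identityʳ _)))

  ∑-swap : (xs : List A) (ys : List B) (f : A → B → ℕ) →
           ∑[ x ← xs ] ∑[ y ← ys ] f x y ≡ ∑[ y ← ys ] ∑[ x ← xs ] f x y
  ∑-swap [] ys f = sym (∑-zero ys (λ _ → refl))
  ∑-swap (x ∷ xs) ys f rewrite ∑-swap xs ys f = sym (∑-+ ys (f x) (λ y → ∑[ x ← xs ] f x y))

  ∑-map : (g : A → B) (xs : List A) (f : B → ℕ) → ∑ (map g xs) f ≡ ∑ xs (f ∘ g)
  ∑-map g [] f = refl
  ∑-map g (x ∷ xs) f = cong (f (g x) +_) (∑-map g xs f)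

  ∑-concatMap : (g : A → List B) (xs : List A) (f : B → ℕ) →
                ∑ (concatMap g xs) f ≡ ∑[ x ← xs ] ∑ (g x) f
  ∑-concatMap g [] f = refl
  ∑-concatMap g (x ∷ xs) f =
    trans (∑-++ (g x) (concatMap g xs) f) (cong (∑ (g x) f +_) (∑-concatMap g xs f))

  ∑-cartesianProduct : (xs : List A) (ys : List B) (f : A × B → ℕ) →
                       ∑ (cartesianProduct xs ys) f ≡ ∑[ x ← xs ] ∑[ y ← ys ] f (x , y)
  ∑-cartesianProduct [] ys f = refl
  ∑-cartesianProduct (x ∷ xs) ys f =
    trans (∑-++ (map (x ,_) ys) _ f) (cong₂ _+_ (∑-map (x ,_) ys f) (∑-cartesianProduct xs ys f))

  ∑-allFin-suc : ∀ n (f : Fin (suc n) → ℕ) → ∑ (allFin (suc n)) f ≡ f Fin.zero + ∑[ x ← allFin n ] f (Fin.suc x)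
  ∑-allFin-suc n f = cong (f Fin.zero +_)
    (trans (cong (λ xs → ∑ xs f) (sym (map-tabulate (λ x → x) Fin.suc))) (∑-map Fin.suc (allFin n) f))

  ⌊suc≟suc⌋ : ∀ {n} (x y : Fin n) → ⌊ Fin.suc x ≟ Fin.suc y ⌋ ≡ ⌊ x ≟ y ⌋
  ⌊suc≟suc⌋ x y with x ≟ y
  ... | yes _ = refl
  ... | no _ = refl

  ∑-allFin-point : ∀ n (v : Fin n) (g : Fin n → ℕ) → ∑[ x ← allFin n ] (𝟙 ⌊ x ≟ v ⌋ * g x) ≡ g v
  ∑-allFin-point (suc n) Fin.zero g rewrite ∑-allFin-suc n (λ x → 𝟙 ⌊ x ≟ Fin.zero ⌋ * g x) =
    trans (cong₂ _+_ (+-identityʳ (g Fin.zero)) (∑-zero (allFin n) (λ _ → refl))) (+-identityʳ _)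
  ∑-allFin-point (suc n) (Fin.suc v) g rewrite ∑-allFin-suc n (λ x → 𝟙 ⌊ x ≟ Fin.suc v ⌋ * g x) =
    trans (∑-cong (allFin n) (λ x → cong (λ b → 𝟙 b * g (Fin.suc x)) (⌊suc≟suc⌋ x v)))
          (∑-allFin-point n v (g ∘ Fin.suc))

  ∑-allFin-atMostOne : ∀ n (R : Fin n → Bool) → (∀ x y → T (R x) → T (R y) → x ≡ y) →
                       ∑[ x ← allFin n ] 𝟙 (R x) ≤ 1
  ∑-allFin-atMostOne zero R unique = z≤n
  ∑-allFin-atMostOne (suc n) R unique rewrite ∑-allFin-suc n (𝟙 ∘ R) with R Fin.zero in R0
  ... | false = ∑-allFin-atMostOne n (R ∘ Fin.suc) (λ x y Rx Ry → Finₚ.suc-injective (unique _ _ Rx Ry))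
  ... | true = ≤-reflexive (cong suc (∑-zero (allFin n) rest))
    where
    rest : ∀ x → 𝟙 (R (Fin.suc x)) ≡ 0
    rest x with R (Fin.suc x) in Rx
    ... | false = refl
    ... | true with () ← unique Fin.zero (Fin.suc x) (subst T (sym R0) tt) (subst T (sym Rx) tt)

  𝟙-∧-covers : ∀ {a b m k} → 1 ≤ 𝟙 a + m → 1 ≤ 𝟙 b + k → 1 ≤ 𝟙 (a ∧ b) + (m + k)
  𝟙-∧-covers {true} {true} _ _ = s≤s z≤n
  𝟙-∧-covers {true} {false} {m} {k} _ 1≤k = ≤-trans 1≤k (m≤n+m k m)
  𝟙-∧-covers {false} {b} {m} {k} 1≤m _ = ≤-trans 1≤m (m≤m+n m k)

  module _ {n : ℕ} (G : Graph n) where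

    VertexSet : Set
    VertexSet = Fin n → Bool

    size : VertexSet → ℕ
    size S = ∑[ x ← allFin n ] 𝟙 (S x)

    degreeIn : VertexSet → Fin n → ℕ
    degreeIn S x = ∑[ u ← allFin n ] 𝟙 (S u ∧ adj G u x)

    degreeSum : VertexSet → ℕ
    degreeSum S = ∑[ x ← allFin n ] (𝟙 (S x) * degreeIn S x)

    MinDegree : VertexSet → ℕ → Set
    MinDegree S a = ∀ v → T (S v) → a ≤ degreeIn S v

    delete : VertexSet → Fin n → VertexSet
    delete S v x = S x ∧ not ⌊ x ≟ v ⌋

    size-delete : (S : VertexSet) (v : Fin n) → T (S v) → size (delete S v) + 1 ≡ size S
    size-delete S v Sv = begin
      size (delete S v) + 1
        ≡⟨ cong (size (delete S v) +_) (sym (trans (∑-allFin-point n v (𝟙 ∘ S)) (𝟙-T Sv))) ⟩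
      size (delete S v) + ∑[ x ← allFin n ] (𝟙 ⌊ x ≟ v ⌋ * 𝟙 (S x))
        ≡⟨ sym (∑-+ (allFin n) _ _) ⟩
      ∑[ x ← allFin n ] (𝟙 (S x ∧ not ⌊ x ≟ v ⌋) + 𝟙 ⌊ x ≟ v ⌋ * 𝟙 (S x))
        ≡⟨ ∑-cong (allFin n) (λ x → split (S x) ⌊ x ≟ v ⌋) ⟩
      size S ∎
      where
      open ≡-Reasoning
      𝟙-T : ∀ {b} → T b → 𝟙 b ≡ 1
      𝟙-T {true} _ = refl
      split : ∀ s e → 𝟙 (s ∧ not e) + 𝟙 e * 𝟙 s ≡ 𝟙 s
      split true true = refl
      split true false = refl
      split false true = refl
      split false false = refl

    degreeSum-delete : (S : VertexSet) (v : Fin n) →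
                       degreeSum S ≤ degreeSum (delete S v) + (degreeIn S v + degreeIn S v)
    degreeSum-delete S v = begin
      degreeSum S
        ≡⟨ ∑-cong V (λ x → sym (∑-*ˡ V (𝟙 (S x)) _)) ⟩
      ∑[ x ← V ] ∑[ u ← V ] (𝟙 (S x) * 𝟙 (S u ∧ adj G u x))
        ≤⟨ ∑-mono-≤ V (λ x → ∑-mono-≤ V (λ u → split (S x) (S u) (adj G u x) ⌊ x ≟ v ⌋ ⌊ u ≟ v ⌋)) ⟩
      ∑[ x ← V ] ∑[ u ← V ] (kept x u + (inRow x u + inColumn x u))
        ≡⟨ ∑-cong V (λ x → trans (∑-+ V (kept x) _) (cong (∑ V (kept x) +_) (∑-+ V (inRow x) (inColumn x)))) ⟩
      ∑[ x ← V ] (∑ V (kept x) + (∑ V (inRow x) + ∑ V (inColumn x)))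
        ≡⟨ trans (∑-+ V _ _) (cong (∑[ x ← V ] ∑ V (kept x) +_) (∑-+ V _ _)) ⟩
      ∑[ x ← V ] ∑ V (kept x) + (∑[ x ← V ] ∑ V (inRow x) + ∑[ x ← V ] ∑ V (inColumn x))
        ≡⟨ cong₂ _+_ keptSum (cong₂ _+_ rowSum columnSum) ⟩
      degreeSum (delete S v) + (degreeIn S v + degreeIn S v) ∎
      where
      open ≤-Reasoning
      V = allFin n
      kept inRow inColumn : Fin n → Fin n → ℕ
      kept x u = 𝟙 (delete S v x) * 𝟙 (delete S v u ∧ adj G u x)
      inRow x u = 𝟙 ⌊ x ≟ v ⌋ * 𝟙 (S u ∧ adj G u x)
      inColumn x u = 𝟙 ⌊ u ≟ v ⌋ * 𝟙 (S x ∧ adj G u x)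
      split : ∀ sx su b ex eu → 𝟙 sx * 𝟙 (su ∧ b) ≤
              𝟙 (sx ∧ not ex) * 𝟙 ((su ∧ not eu) ∧ b) + (𝟙 ex * 𝟙 (su ∧ b) + 𝟙 eu * 𝟙 (sx ∧ b))
      split false su b ex eu = z≤n
      split true false b ex eu = z≤n
      split true true false ex eu = z≤n
      split true true true true eu = s≤s z≤n
      split true true true false true = s≤s z≤n
      split true true true false false = s≤s z≤n
      keptSum : ∑[ x ← V ] ∑ V (kept x) ≡ degreeSum (delete S v)
      keptSum = ∑-cong V (λ x → ∑-*ˡ V (𝟙 (delete S v x)) _)
      rowSum : ∑[ x ← V ] ∑ V (inRow x) ≡ degreeIn S v
      rowSum = trans (∑-cong V (λ x → ∑-*ˡ V (𝟙 ⌊ x ≟ v ⌋) _)) (∑-allFin-point n v (degreeIn S))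
      columnSum : ∑[ x ← V ] ∑ V (inColumn x) ≡ degreeIn S v
      columnSum = begin-equality
        ∑[ x ← V ] ∑ V (inColumn x)
          ≡⟨ ∑-swap V V inColumn ⟩
        ∑[ u ← V ] (∑[ x ← V ] inColumn x u)
          ≡⟨ ∑-cong V (λ u → ∑-*ˡ V (𝟙 ⌊ u ≟ v ⌋) _) ⟩
        ∑[ u ← V ] (𝟙 ⌊ u ≟ v ⌋ * ∑[ x ← V ] 𝟙 (S x ∧ adj G u x))
          ≡⟨ ∑-allFin-point n v (λ u → ∑[ x ← V ] 𝟙 (S x ∧ adj G u x)) ⟩
        ∑[ x ← V ] 𝟙 (S x ∧ adj G v x)
          ≡⟨ ∑-cong V (λ x → cong (λ b → 𝟙 (S x ∧ b)) (adj-sym G v x)) ⟩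
        degreeIn S v ∎

    module _ (s : ℕ) where

      lowVertex? : (S : VertexSet) → Dec (∃[ v ] T (S v) × degreeIn S v ≤ s)
      lowVertex? S = Finₚ.any? (λ v → T? (S v) ×-dec (degreeIn S v ≤? s))

      prune : ℕ → VertexSet → VertexSet
      prune zero S = S
      prune (suc f) S with lowVertex? S
      ... | yes (v , _) = prune f (delete S v)
      ... | no _ = S

      prune-degreeSum : ∀ f S → degreeSum S ≤ degreeSum (prune f S) + f * (s + s)
      prune-degreeSum zero S = ≤-reflexive (sym (+-identityʳ (degreeSum S)))
      prune-degreeSum (suc f) S with lowVertex? S
      ... | yes (v , _ , low) = begin
        degreeSum S                                              ≤⟨ degreeSum-delete S v ⟩
        degreeSum (delete S v) + (degreeIn S v + degreeIn S v)   ≤⟨ +-mono-≤ (prune-degreeSum f (delete S v)) (+-mono-≤ low low) ⟩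
        degreeSum S′ + f * (s + s) + (s + s)                     ≡⟨ +-assoc (degreeSum S′) (f * (s + s)) (s + s) ⟩
        degreeSum S′ + (f * (s + s) + (s + s))                   ≡⟨ cong (degreeSum S′ +_) (+-comm (f * (s + s)) (s + s)) ⟩
        degreeSum S′ + suc f * (s + s)                           ∎
        where
        open ≤-Reasoning
        S′ = prune f (delete S v)
      ... | no _ = m≤m+n (degreeSum S) _

      prune-minDegree : ∀ f S → size S ≤ f → MinDegree (prune f S) (suc s)
      prune-minDegree zero S sizeS≤0 v Sv = ⊥-elim (1+n≰n (≤-trans 1≤size sizeS≤0))
        where
        1≤size : 1 ≤ size S
        1≤size = subst (1 ≤_) (trans (+-comm 1 _) (size-delete S v Sv)) (s≤s z≤n)
      prune-minDegree (suc f) S sizeS≤f v Sv with lowVertex? S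
      ... | yes (u , Su , _) = prune-minDegree f (delete S u) size≤f v Sv
        where
        size≤f : size (delete S u) ≤ f
        size≤f = s≤s⁻¹ (subst (_≤ suc f) (sym (trans (+-comm 1 _) (size-delete S u Su))) sizeS≤f)
      ... | no noLow = ≰⇒> (λ low → noLow (v , Sv , low))

    everything : VertexSet
    everything _ = true

    size-everything : size everything ≡ n
    size-everything = trans (∑-const-1 (allFin n)) (length-tabulate (λ x → x))

    edgeCount-handshake : edgeCount G + edgeCount G ≤ degreeSum everything
    edgeCount-handshake = begin
      E + E
        ≡⟨ cong₂ _+_ E≡ (trans E≡ (∑-swap V V below)) ⟩
      ∑[ u ← V ] ∑[ v ← V ] below u v + ∑[ u ← V ] ∑[ v ← V ] below v u
        ≡⟨ sym (∑-+ V _ _) ⟩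
      ∑[ u ← V ] (∑[ v ← V ] below u v + ∑[ v ← V ] below v u)
        ≡⟨ ∑-cong V (λ u → sym (∑-+ V (below u) (λ v → below v u))) ⟩
      ∑[ u ← V ] ∑[ v ← V ] (below u v + below v u)
        ≤⟨ ∑-mono-≤ V (λ u → ∑-mono-≤ V (λ v → below-both u v)) ⟩
      ∑[ u ← V ] ∑[ v ← V ] 𝟙 (adj G v u)
        ≡⟨ ∑-cong V (λ u → sym (+-identityʳ _)) ⟩
      degreeSum everything ∎
      where
      open ≤-Reasoning
      V = allFin n
      E = edgeCount G
      isEdge : (p : Fin n × Fin n) → Dec (adj G (proj₁ p) (proj₂ p) ≡ true)
      isEdge p = adj G (proj₁ p) (proj₂ p) Bool.≟ true
      ascending : (p : Fin n × Fin n) → Dec (toℕ (proj₁ p) < toℕ (proj₂ p))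
      ascending p = toℕ (proj₁ p) ℕ.<? toℕ (proj₂ p)
      below : Fin n → Fin n → ℕ
      below u v = 𝟙 (does (isEdge (u , v))) * 𝟙 (does (ascending (u , v)))
      E≡ : E ≡ ∑[ u ← V ] ∑[ v ← V ] below u v
      E≡ = begin-equality
        E
          ≡⟨ length-filter ascending (filter isEdge (cartesianProduct V V)) ⟩
        ∑ (filter isEdge (cartesianProduct V V)) (λ p → 𝟙 (does (ascending p)))
          ≡⟨ ∑-filter isEdge (cartesianProduct V V) _ ⟩
        ∑ (cartesianProduct V V) (λ p → 𝟙 (does (isEdge p)) * 𝟙 (does (ascending p)))
          ≡⟨ ∑-cartesianProduct V V _ ⟩
        ∑[ u ← V ] ∑[ v ← V ] below u v ∎
      below-both : ∀ u v → below u v + below v u ≤ 𝟙 (adj G v u)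
      below-both u v rewrite adj-sym G u v with adj G v u
      ... | false = z≤n
      ... | true with toℕ u ℕ.<ᵇ toℕ v in u<v | toℕ v ℕ.<ᵇ toℕ u in v<u
      ...   | true | true = ⊥-elim (<-asym (<ᵇ⇒< (toℕ u) (toℕ v) (subst T (sym u<v) tt))
                                         (<ᵇ⇒< (toℕ v) (toℕ u) (subst T (sym v<u) tt)))
      ...   | true | false = s≤s z≤n
      ...   | false | true = s≤s z≤n
      ...   | false | false = z≤n

  fresh : {A : Set} → (A → A → Bool) → A → List A → Bool
  fresh eq x xs = all (λ y → not (eq x y)) xs

  allDistinct-∷⁺ : {A : Set} (eq : A → A → Bool) (x : A) (xs : List A) →
                   T (fresh eq x xs) → T (allDistinct eq xs) → T (allDistinct eq (x ∷ xs))
  allDistinct-∷⁺ eq x [] _ _ = tt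
  allDistinct-∷⁺ eq x (y ∷ ys) fresh distinct =
    let x≢y , fresh′ = T-∧ .to fresh
        _ , distinct′ = T-∧ .to distinct
        x∉ys , _ = T-∧ .to (allDistinct-∷⁺ eq x ys fresh′ distinct′)
    in T-∧ .from (T-∧ .from (x≢y , x∉ys) , distinct)

  length-consecutive : {A : Set} (x : A) (xs : List A) → length (consecutive (x ∷ xs)) ≡ length xs
  length-consecutive x [] = refl
  length-consecutive x (y ∷ xs) = cong suc (length-consecutive y xs)

  fresh-or-∑ : {A : Set} (eq : A → A → Bool) (x : A) (xs : List A) →
               1 ≤ 𝟙 (fresh eq x xs) + ∑[ y ← xs ] 𝟙 (eq x y)
  fresh-or-∑ eq x [] = s≤s z≤n
  fresh-or-∑ eq x (y ∷ xs) with eq x y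
  ... | true = s≤s z≤n
  ... | false = fresh-or-∑ eq x xs

  module _ {n : ℕ} (G : Graph n) (c : EdgeColouring G) where

    _≟ᵛ_ : Fin n → Fin n → Bool
    u ≟ᵛ v = ⌊ u ≟ v ⌋

    _≟ᶜ_ : ℕ → ℕ → Bool
    a ≟ᶜ b = ⌊ a ℕ.≟ b ⌋

    colours : List (Fin n) → List ℕ
    colours L = map (λ e → c (proj₁ e) (proj₂ e)) (consecutive L)

    IsRainbow : List (Fin n) → Bool
    IsRainbow L = allDistinct _≟ᵛ_ L ∧ allEdges G (consecutive L) ∧ allDistinct _≟ᶜ_ (colours L)

    extends : VertexSet G → Fin n → List (Fin n) → Bool
    extends S v [] = false
    extends S v (w ∷ L) = S v ∧ adj G v w ∧ fresh _≟ᵛ_ v (w ∷ L) ∧ fresh _≟ᶜ_ (c v w) (colours (w ∷ L))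

    RainbowIn : VertexSet G → List (Fin n) → Bool
    RainbowIn S [] = false
    RainbowIn S (v ∷ []) = S v
    RainbowIn S (v ∷ w ∷ L) = RainbowIn S (w ∷ L) ∧ extends S v (w ∷ L)

    RainbowIn⇒IsRainbow : (S : VertexSet G) (L : List (Fin n)) → T (RainbowIn S L) → T (IsRainbow L)
    RainbowIn⇒IsRainbow S (v ∷ []) _ = tt
    RainbowIn⇒IsRainbow S (v ∷ w ∷ L) rainbow =
      let rainbow′ , extension = T-∧ .to rainbow
          distinct , edges , distinctColours =
            T-∧³ {allDistinct _≟ᵛ_ (w ∷ L)} {allEdges G (consecutive (w ∷ L))} (RainbowIn⇒IsRainbow S (w ∷ L) rainbow′)
          _ , vw , freshVertex , freshColour = T-∧⁴ {S v} {adj G v w} {fresh _≟ᵛ_ v (w ∷ L)} extension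
      in T-∧ .from ( allDistinct-∷⁺ _≟ᵛ_ v (w ∷ L) freshVertex distinct
                   , T-∧ .from ( T-∧ .from (vw , edges)
                               , allDistinct-∷⁺ _≟ᶜ_ (c v w) (colours (w ∷ L)) freshColour distinctColours))
      where
      T-∧³ : ∀ {a b d} → T (a ∧ b ∧ d) → T a × T b × T d
      T-∧³ t = let x , y = T-∧ .to t in x , T-∧ .to y
      T-∧⁴ : ∀ {a b d e} → T (a ∧ b ∧ d ∧ e) → T a × T b × T d × T e
      T-∧⁴ t = let x , y = T-∧ .to t in x , T-∧³ y

    T-adj∧colour : ∀ {col} z w → T (adj G z w ∧ c z w ≟ᶜ col) → T (adj G z w) × c z w ≡ col
    T-adj∧colour z w t with adj G z w
    ... | true = tt , toWitness t

    RainbowIn-head : (S : VertexSet G) (w : Fin n) (L : List (Fin n)) → T (RainbowIn S (w ∷ L)) → T (S w)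
    RainbowIn-head S w [] rainbow = rainbow
    RainbowIn-head S w (x ∷ L) rainbow = proj₁ (T-∧ .to (proj₂ (T-∧ {RainbowIn S (x ∷ L)} .to rainbow)))

    pathsIn : VertexSet G → ℕ → ℕ
    pathsIn S j = ∑[ w ← allVecs n (suc j) ] 𝟙 (RainbowIn S (toList w))

    pathsIn-≤-rainbowPathCount : (S : VertexSet G) (k : ℕ) → pathsIn S k ≤ rainbowPathCount G c k
    pathsIn-≤-rainbowPathCount S k = begin
      pathsIn S k ≤⟨ ∑-mono-≤ W (λ w → 𝟙-mono (RainbowIn⇒IsRainbow S (toList w))) ⟩
      ∑[ w ← W ] 𝟙 (isRainbowPath G c w) ≡⟨ ∑-cong W (λ w → 𝟙-does (isRainbowPath G c w)) ⟨
      ∑[ w ← W ] 𝟙 (does (isRainbowPath G c w Bool.≟ true)) ≡⟨ length-filter (λ w → isRainbowPath G c w Bool.≟ true) W ⟨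
      rainbowPathCount G c k ∎
      where
      open ≤-Reasoning
      W = allVecs n (suc k)
      𝟙-mono : ∀ {a b} → (T a → T b) → 𝟙 a ≤ 𝟙 b
      𝟙-mono {false} _ = z≤n
      𝟙-mono {true} {true} _ = ≤-refl
      𝟙-mono {true} {false} a⇒b = ⊥-elim (a⇒b tt)
      𝟙-does : ∀ b → 𝟙 (does (b Bool.≟ true)) ≡ 𝟙 b
      𝟙-does false = refl
      𝟙-does true = refl

    module _ (symmetric : SymmetricColouring G c) (proper : Proper G c) where

      T-adj∧colour-unique : (w : Fin n) (col : ℕ) (x y : Fin n) →
                            T (adj G x w ∧ c x w ≟ᶜ col) → T (adj G y w ∧ c y w ≟ᶜ col) → x ≡ y
      T-adj∧colour-unique w col x y xw yw with x ≟ y | T-adj∧colour x w xw | T-adj∧colour y w yw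
      ... | yes x≡y | _ | _ = x≡y
      ... | no x≢y | x~w , cx | y~w , cy = ⊥-elim (proper w x y (flip x~w) (flip y~w) x≢y (begin
          c w x ≡⟨ symmetric w x (flip x~w) ⟩
          c x w ≡⟨ trans cx (sym cy) ⟩
          c y w ≡⟨ symmetric y w y~w ⟩
          c w y ∎))
        where
        open ≡-Reasoning
        flip : ∀ {z} → T (adj G z w) → T (adj G w z)
        flip {z} = subst T (adj-sym G z w)

      -- A neighbour v of w that does not extend the path either lies on it or repeats one of its
      -- colours on vw; by properness each colour is carried by at most one edge at w.
      degreeIn-≤-extensions : (S : VertexSet G) (w : Fin n) (L : List (Fin n)) →
        degreeIn G S w ≤ ∑[ v ← allFin n ] 𝟙 (extends S v (w ∷ L)) + (length L + length L)
      degreeIn-≤-extensions S w L = begin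
        degreeIn G S w
          ≤⟨ ∑-mono-≤ V blocked ⟩
        ∑[ v ← V ] (extension v + (onPath v + sameColour v))
          ≡⟨ trans (∑-+ V _ _) (cong (∑ V extension +_) (∑-+ V _ _)) ⟩
        ∑ V extension + (∑ V onPath + ∑ V sameColour)
          ≤⟨ +-monoʳ-≤ (∑ V extension) (+-mono-≤ onPath-≤ sameColour-≤) ⟩
        ∑ V extension + (length L + length L) ∎
        where
        open ≤-Reasoning
        V = allFin n
        Cs = colours (w ∷ L)
        extension onPath sameColour : Fin n → ℕ
        extension v = 𝟙 (extends S v (w ∷ L))
        onPath v = ∑[ y ← L ] 𝟙 (v ≟ᵛ y)
        sameColour v = ∑[ col ← Cs ] 𝟙 (adj G v w ∧ c v w ≟ᶜ col)
        blocked : ∀ v → 𝟙 (S v ∧ adj G v w) ≤ extension v + (onPath v + sameColour v)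
        blocked v with S v | adj G v w in v~w | v ≟ w
        ... | false | _ | _ = z≤n
        ... | true | false | _ = z≤n
        ... | true | true | yes refl with () ← trans (sym v~w) (adj-irref G v)
        ... | true | true | no _ =
          𝟙-∧-covers {fresh _≟ᵛ_ v L} {fresh _≟ᶜ_ (c v w) Cs} (fresh-or-∑ _≟ᵛ_ v L) (fresh-or-∑ _≟ᶜ_ (c v w) Cs)
        onPath-≤ : ∑ V onPath ≤ length L
        onPath-≤ = ≤-trans (≤-reflexive (∑-swap V L _)) (∑-≤-length L (λ y →
          ∑-allFin-atMostOne n (_≟ᵛ y) (λ a b a≡y b≡y → trans (toWitness a≡y) (sym (toWitness b≡y)))))
        sameColour-≤ : ∑ V sameColour ≤ length L
        sameColour-≤ = begin
          ∑ V sameColour ≡⟨ ∑-swap V Cs _ ⟩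
          ∑[ col ← Cs ] ∑[ v ← V ] 𝟙 (adj G v w ∧ c v w ≟ᶜ col)
            ≤⟨ ∑-≤-length Cs (λ col → ∑-allFin-atMostOne n _ (T-adj∧colour-unique w col)) ⟩
          length Cs ≡⟨ trans (length-map _ (consecutive (w ∷ L))) (length-consecutive w L) ⟩
          length L ∎

      pathsIn-suc : (S : VertexSet G) (j : ℕ) →
        ∑[ w ← allVecs n (suc j) ] (𝟙 (RainbowIn S (toList w)) * (degreeIn G S (Vec.head w) ∸ (j + j)))
          ≤ pathsIn S (suc j)
      pathsIn-suc S j = begin
        ∑[ w ← W ] (𝟙 (RainbowIn S (toList w)) * (degreeIn G S (Vec.head w) ∸ (j + j)))
          ≤⟨ ∑-mono-≤ W prepend ⟩
        ∑[ w ← W ] ∑[ v ← V ] rainbow (v Vec.∷ w)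
          ≡⟨ ∑-swap W V (λ w v → rainbow (v Vec.∷ w)) ⟩
        ∑[ v ← V ] ∑[ w ← W ] rainbow (v Vec.∷ w)
          ≡⟨ ∑-cong V (λ v → ∑-map (v Vec.∷_) W rainbow) ⟨
        ∑[ v ← V ] ∑ (map (v Vec.∷_) W) rainbow
          ≡⟨ ∑-concatMap (λ v → map (v Vec.∷_) W) V rainbow ⟨
        pathsIn S (suc j) ∎
        where
        open ≤-Reasoning
        V = allFin n
        W = allVecs n (suc j)
        rainbow : Vec (Fin n) (suc (suc j)) → ℕ
        rainbow w = 𝟙 (RainbowIn S (toList w))
        prepend : (w : Vec (Fin n) (suc j)) →
          𝟙 (RainbowIn S (toList w)) * (degreeIn G S (Vec.head w) ∸ (j + j)) ≤ ∑[ v ← V ] rainbow (v Vec.∷ w)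
        prepend (w Vec.∷ w′) = begin
          𝟙 (RainbowIn S (w ∷ L)) * (degreeIn G S w ∸ (j + j))
            ≤⟨ *-monoʳ-≤ (𝟙 (RainbowIn S (w ∷ L))) enough ⟩
          𝟙 (RainbowIn S (w ∷ L)) * ∑[ v ← V ] 𝟙 (extends S v (w ∷ L))
            ≡⟨ ∑-*ˡ V (𝟙 (RainbowIn S (w ∷ L))) (λ v → 𝟙 (extends S v (w ∷ L))) ⟨
          ∑[ v ← V ] (𝟙 (RainbowIn S (w ∷ L)) * 𝟙 (extends S v (w ∷ L)))
            ≡⟨ ∑-cong V (λ v → 𝟙-∧ (RainbowIn S (w ∷ L)) (extends S v (w ∷ L))) ⟨
          ∑[ v ← V ] rainbow (v Vec.∷ w Vec.∷ w′) ∎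
          where
          L = toList w′
          extensions : ℕ
          extensions = ∑[ v ← V ] 𝟙 (extends S v (w ∷ L))
          enough : degreeIn G S w ∸ (j + j) ≤ extensions
          enough = m≤n+o⇒m∸n≤o (degreeIn G S w) (j + j) (begin
            degreeIn G S w                ≤⟨ degreeIn-≤-extensions S w L ⟩
            extensions + (length L + length L) ≡⟨ cong (λ l → extensions + (l + l)) (length-toList w′) ⟩
            extensions + (j + j)          ≡⟨ +-comm extensions (j + j) ⟩
            (j + j) + extensions          ∎)

      pathsIn-one : (S : VertexSet G) → degreeSum G S ≤ pathsIn S 1
      pathsIn-one S = ≤-trans (≤-reflexive singletons) (pathsIn-suc S 0)
        where
        singletons : degreeSum G S ≡ ∑[ w ← allVecs n 1 ] (𝟙 (RainbowIn S (toList w)) * (degreeIn G S (Vec.head w) ∸ 0))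
        singletons = trans (∑-cong (allFin n) (λ v → sym (+-identityʳ _))) (sym (∑-concatMap _ (allFin n) _))

      pathsIn-grow : (S : VertexSet G) (a : ℕ) → MinDegree G S a → ∀ j →
                     pathsIn S j * (a ∸ (j + j)) ≤ pathsIn S (suc j)
      pathsIn-grow S a minDegree j = begin
        pathsIn S j * (a ∸ (j + j))
          ≡⟨ ∑-*ʳ W _ _ ⟨
        ∑[ w ← W ] (𝟙 (RainbowIn S (toList w)) * (a ∸ (j + j)))
          ≤⟨ ∑-mono-≤ W headDegree ⟩
        ∑[ w ← W ] (𝟙 (RainbowIn S (toList w)) * (degreeIn G S (Vec.head w) ∸ (j + j)))
          ≤⟨ pathsIn-suc S j ⟩
        pathsIn S (suc j) ∎
        where
        open ≤-Reasoning
        W = allVecs n (suc j)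
        headDegree : (w : Vec (Fin n) (suc j)) →
          𝟙 (RainbowIn S (toList w)) * (a ∸ (j + j)) ≤ 𝟙 (RainbowIn S (toList w)) * (degreeIn G S (Vec.head w) ∸ (j + j))
        headDegree (w Vec.∷ w′) with RainbowIn S (w ∷ toList w′) in rainbow
        ... | false = z≤n
        ... | true = *-monoʳ-≤ 1 (∸-monoˡ-≤ (j + j) (minDegree w (RainbowIn-head S w (toList w′) (subst T (sym rainbow) tt))))

      pathsIn-pow : (S : VertexSet G) (a : ℕ) → MinDegree G S a → ∀ m →
                    degreeSum G S * (a ∸ (m + m)) ^ m ≤ pathsIn S (suc m)
      pathsIn-pow S a minDegree zero = ≤-trans (≤-reflexive (*-identityʳ _)) (pathsIn-one S)
      pathsIn-pow S a minDegree (suc m) = begin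
        degreeSum G S * (b′ * b′ ^ m)      ≡⟨ cong (degreeSum G S *_) (*-comm b′ _) ⟩
        degreeSum G S * (b′ ^ m * b′)      ≡⟨ *-assoc (degreeSum G S) (b′ ^ m) b′ ⟨
        degreeSum G S * b′ ^ m * b′        ≤⟨ *-monoˡ-≤ b′ (*-monoʳ-≤ (degreeSum G S) (^-monoˡ-≤ m b′≤b)) ⟩
        degreeSum G S * b ^ m * b′         ≤⟨ *-monoˡ-≤ b′ (pathsIn-pow S a minDegree m) ⟩
        pathsIn S (suc m) * b′             ≤⟨ pathsIn-grow S a minDegree (suc m) ⟩
        pathsIn S (suc (suc m))            ∎
        where
        open ≤-Reasoning
        b = a ∸ (m + m)
        b′ = a ∸ (suc m + suc m)
        b′≤b : b′ ≤ b
        b′≤b = ∸-monoʳ-≤ a (+-mono-≤ (n≤1+n m) (n≤1+n m))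

      rainbowPathCount-≥ : ∀ s m → ∃[ h ] (edgeCount G + edgeCount G ≤ h + n * (s + s))
                                        × (h * (suc s ∸ (m + m)) ^ m ≤ rainbowPathCount G c (suc m))
      rainbowPathCount-≥ s m =
          degreeSum G core
        , ≤-trans (edgeCount-handshake G) (prune-degreeSum G s n (everything G))
        , ≤-trans (pathsIn-pow core (suc s) (prune-minDegree G s n (everything G) (≤-reflexive (size-everything G))) m)
                  (pathsIn-≤-rainbowPathCount core (suc m))
        where
        core = prune G s n (everything G)

  m<[1+m/n]*n : ∀ m n .{{_ : NonZero n}} → m < suc (m / n) * n
  m<[1+m/n]*n m n = begin-strict
    m                   ≡⟨ m≡m%n+[m/n]*n m n ⟩
    m % n + m / n * n   <⟨ +-monoˡ-< (m / n * n) (m%n<n m n) ⟩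
    suc (m / n) * n     ∎
    where open ≤-Reasoning

  *-^-distrib : ∀ x y m → (x * y) ^ m ≡ x ^ m * y ^ m
  *-^-distrib x y zero = refl
  *-^-distrib x y (suc m) rewrite *-^-distrib x y m = *-interchange x y (x ^ m) (y ^ m)

  np≤hq : ∀ n p q e h s → n * p ≤ e * q → e + e ≤ h + n * (s + s) → s * (q * 2) ≤ p → n * p ≤ h * q
  np≤hq n p q e h s np≤eq 2e≤h+2ns 2qs≤p = +-cancelʳ-≤ (n * p) (n * p) (h * q) (begin
    n * p + n * p               ≤⟨ +-mono-≤ np≤eq np≤eq ⟩
    e * q + e * q               ≡⟨ *-distribʳ-+ q e e ⟨
    (e + e) * q                 ≤⟨ *-monoˡ-≤ q 2e≤h+2ns ⟩
    (h + n * (s + s)) * q       ≡⟨ expand h n s q ⟩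
    h * q + n * (s * (q * 2))   ≤⟨ +-monoʳ-≤ (h * q) (*-monoʳ-≤ n 2qs≤p) ⟩
    h * q + n * p               ∎)
    where
    open ≤-Reasoning
    expand : ∀ h n s q → (h + n * (s + s)) * q ≡ h * q + n * (s * (q * 2))
    expand = solve-∀

  p≤4q[1+s∸2m] : ∀ p q s k m → k * (q * 8) < p → p < suc s * (q * 2) → m ≤ k → p ≤ q * 4 * (suc s ∸ (m + m))
  p≤4q[1+s∸2m] p q s k m 8kq<p p<2q[1+s] m≤k =
    ≤-trans (m+n≤o⇒m≤o∸n p bound) (≤-reflexive (sym (*-distribˡ-∸ (q * 4) (suc s) (m + m))))
    where
    open ≤-Reasoning
    bound : p + q * 4 * (m + m) ≤ q * 4 * suc s
    bound = begin
      p + q * 4 * (m + m)             ≡⟨ cong (p +_) (regroup q m) ⟩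
      p + m * (q * 8)                 ≤⟨ +-monoʳ-≤ p (≤-trans (*-monoˡ-≤ (q * 8) m≤k) (<⇒≤ 8kq<p)) ⟩
      p + p                           ≤⟨ +-mono-≤ (<⇒≤ p<2q[1+s]) (<⇒≤ p<2q[1+s]) ⟩
      suc s * (q * 2) + suc s * (q * 2) ≡⟨ double (suc s) q ⟩
      q * 4 * suc s                   ∎
      where
      regroup : ∀ q m → q * 4 * (m + m) ≡ m * (q * 8)
      regroup = solve-∀
      double : ∀ a q → a * (q * 2) + a * (q * 2) ≡ q * 4 * a
      double = solve-∀

  np^[1+m]≤P[4q]^[1+m] : ∀ n p q h b P m → n * p ≤ h * q → p ≤ q * 4 * b → h * b ^ m ≤ P → n * p ^ suc m ≤ P * (q * 4) ^ suc m
  np^[1+m]≤P[4q]^[1+m] n p q h b P m np≤hq p≤4qb hb^m≤P = begin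
    n * (p * p ^ m)               ≡⟨ *-assoc n p (p ^ m) ⟨
    n * p * p ^ m                 ≤⟨ *-mono-≤ np≤hq (^-monoˡ-≤ m p≤4qb) ⟩
    h * q * (q * 4 * b) ^ m       ≡⟨ cong (h * q *_) (*-^-distrib (q * 4) b m) ⟩
    h * q * ((q * 4) ^ m * b ^ m) ≡⟨ regroup h q ((q * 4) ^ m) (b ^ m) ⟩
    h * b ^ m * (q * (q * 4) ^ m) ≤⟨ *-mono-≤ hb^m≤P (*-monoˡ-≤ ((q * 4) ^ m) (m≤m*n q 4)) ⟩
    P * (q * 4 * (q * 4) ^ m)     ∎
    where
    open ≤-Reasoning
    regroup : ∀ h q x y → h * q * (x * y) ≡ h * y * (q * x)
    regroup = solve-∀

  rainbowPathCount-cleared : ∀ {n} (G : Graph n) (c : EdgeColouring G) → SymmetricColouring G c → Proper G c →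
    ∀ p q m .{{_ : NonZero q}} → n * p ≤ edgeCount G * q → suc m * (q * 8) < p →
    n * p ^ suc m ≤ rainbowPathCount G c (suc m) * (q * 4) ^ suc m
  rainbowPathCount-cleared {n} G c symmetric proper p q m np≤eq 8kq<p =
    np^[1+m]≤P[4q]^[1+m] n p q h (suc s ∸ (m + m)) (rainbowPathCount G c (suc m)) m
      (np≤hq n p q (edgeCount G) h s np≤eq 2e≤h+2ns (m/n*n≤m p (q * 2)))
      (p≤4q[1+s∸2m] p q s (suc m) m 8kq<p (m<[1+m/n]*n p (q * 2)) (n≤1+n m))
      hb^m≤P
    where
    instance _ = m*n≢0 q 2
    s = p / (q * 2)
    core = rainbowPathCount-≥ G c symmetric proper s m
    h = proj₁ core
    2e≤h+2ns = proj₁ (proj₂ core)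
    hb^m≤P = proj₂ (proj₂ core)

module Rationals where

  open import Data.Nat as ℕ using (ℕ; zero; suc)
  import Data.Nat.Properties as ℕ
  open import Data.Integer as ℤ using (+_; -[1+_])
  import Data.Integer.Properties as ℤ
  open import Data.Rational using (ℚ; mkℚ; _*_; _/_; _≤_; _<_; toℚᵘ)
  import Data.Rational.Properties as ℚ
  open import Data.Rational.Unnormalised as ℚᵘ using (ℚᵘ; mkℚᵘ; *≤*; *<*)
  import Data.Rational.Unnormalised.Properties as ℚᵘ
  import Data.Nat.Coprimality as Coprime
  open import Relation.Nullary using (¬_)
  open import Relation.Binary.PropositionalEquality

  -- ℚ normalises fractions, so numerators and denominators are tracked in ℚᵘ, where they multiply.
  record Represents (x : ℚᵘ) (u D : ℕ) : Set where
    constructor represents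
    field
      numerator : ℚᵘ.↥ x ≡ + u
      denominator : ℚᵘ.↧ₙ x ≡ D

  Represents-* : ∀ {x y u v D E} → Represents x u D → Represents y v E → Represents (x ℚᵘ.* y) (u ℕ.* v) (D ℕ.* E)
  Represents-* {mkℚᵘ _ _} {mkℚᵘ _ _} {u} {v} (represents refl refl) (represents refl refl) = represents (sym (ℤ.pos-* u v)) refl

  _^ᵘ_ : ℚᵘ → ℕ → ℚᵘ
  x ^ᵘ zero = ℚᵘ.1ℚᵘ
  x ^ᵘ suc k = x ℚᵘ.* (x ^ᵘ k)

  Represents-^ : ∀ {x u D} → Represents x u D → ∀ k → Represents (x ^ᵘ k) (u ℕ.^ k) (D ℕ.^ k)
  Represents-^ r zero = represents refl refl
  Represents-^ {x} r (suc k) = Represents-* {x} {x ^ᵘ k} r (Represents-^ {x} r k)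

  Represents-≤ : ∀ {x y u v D E} → Represents x u D → Represents y v E → u ℕ.* E ℕ.≤ v ℕ.* D → x ℚᵘ.≤ y
  Represents-≤ {mkℚᵘ _ _} {mkℚᵘ _ _} {u} {v} (represents refl refl) (represents refl refl) uE≤vD =
    *≤* (subst₂ ℤ._≤_ (ℤ.pos-* u _) (ℤ.pos-* v _) (ℤ.+≤+ uE≤vD))

  Represents-≤⁻ : ∀ {x y u v D E} → Represents x u D → Represents y v E → x ℚᵘ.≤ y → u ℕ.* E ℕ.≤ v ℕ.* D
  Represents-≤⁻ {mkℚᵘ _ _} {mkℚᵘ _ _} {u} {v} (represents refl refl) (represents refl refl) (*≤* le) =
    ℤ.drop‿+≤+ (subst₂ ℤ._≤_ (sym (ℤ.pos-* u _)) (sym (ℤ.pos-* v _)) le)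

  Represents-<⁻ : ∀ {x y u v D E} → Represents x u D → Represents y v E → x ℚᵘ.< y → u ℕ.* E ℕ.< v ℕ.* D
  Represents-<⁻ {mkℚᵘ _ _} {mkℚᵘ _ _} {u} {v} (represents refl refl) (represents refl refl) (*<* lt) =
    ℤ.drop‿+<+ (subst₂ ℤ._<_ (sym (ℤ.pos-* u _)) (sym (ℤ.pos-* v _)) lt)

  toℚᵘ-⟦⟧ : ∀ m → toℚᵘ ⟦ m ⟧ ≡ mkℚᵘ (+ m) 0
  toℚᵘ-⟦⟧ m = cong toℚᵘ (ℚ.↥p/↧p≡p (mkℚ (+ m) 0 (Coprime.sym (Coprime.1-coprimeTo m))))

  Represents-⟦⟧ : ∀ m → Represents (toℚᵘ ⟦ m ⟧) m 1
  Represents-⟦⟧ m rewrite toℚᵘ-⟦⟧ m = represents refl refl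

  toℚᵘ-^ℚ : ∀ x k → toℚᵘ (x ^ℚ k) ℚᵘ.≃ toℚᵘ x ^ᵘ k
  toℚᵘ-^ℚ x zero = ℚᵘ.≃-refl
  toℚᵘ-^ℚ x (suc k) = ℚᵘ.≃-trans (ℚ.toℚᵘ-homo-* x (x ^ℚ k)) (ℚᵘ.*-congˡ {toℚᵘ x} (toℚᵘ-^ℚ x k))

  ^ᵘ-cong : ∀ {x y} → x ℚᵘ.≃ y → ∀ k → x ^ᵘ k ℚᵘ.≃ y ^ᵘ k
  ^ᵘ-cong x≃y zero = ℚᵘ.≃-refl
  ^ᵘ-cong x≃y (suc k) = ℚᵘ.*-cong x≃y (^ᵘ-cong x≃y k)

  module _ (d : ℚ) {p q : ℕ} (d≐p/q : Represents (toℚᵘ d) p q) where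

    ⟦⟧*≤⟦⟧⇒ : ∀ n m → ⟦ n ⟧ * d ≤ ⟦ m ⟧ → n ℕ.* p ℕ.≤ m ℕ.* q
    ⟦⟧*≤⟦⟧⇒ n m nd≤m = subst₂ ℕ._≤_ (ℕ.*-identityʳ (n ℕ.* p)) (cong (m ℕ.*_) (ℕ.*-identityˡ q))
      (Represents-≤⁻ {toℚᵘ ⟦ n ⟧ ℚᵘ.* toℚᵘ d} (Represents-* {toℚᵘ ⟦ n ⟧} (Represents-⟦⟧ n) d≐p/q) (Represents-⟦⟧ m)
        (ℚᵘ.≤-respˡ-≃ (ℚ.toℚᵘ-homo-* ⟦ n ⟧ d) (ℚ.toℚᵘ-mono-≤ nd≤m)))

    ⟦⟧<*1/8⇒ : ∀ k → ⟦ k ⟧ < d * (+ 1 / 8) → k ℕ.* (q ℕ.* 8) ℕ.< p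
    ⟦⟧<*1/8⇒ k k<d/8 = subst (k ℕ.* (q ℕ.* 8) ℕ.<_) (trans (ℕ.*-identityʳ _) (ℕ.*-identityʳ p))
      (Represents-<⁻ {toℚᵘ ⟦ k ⟧} {toℚᵘ d ℚᵘ.* toℚᵘ (+ 1 / 8)}
        (Represents-⟦⟧ k) (Represents-* {toℚᵘ d} d≐p/q (represents refl refl))
        (ℚᵘ.<-respʳ-≃ (ℚ.toℚᵘ-homo-* d (+ 1 / 8)) (ℚ.toℚᵘ-mono-< k<d/8)))

    ⟦⟧*[*1/4]^≤⟦⟧⇐ : ∀ n m k → n ℕ.* p ℕ.^ k ℕ.≤ m ℕ.* (q ℕ.* 4) ℕ.^ k → ⟦ n ⟧ * ((d * (+ 1 / 4)) ^ℚ k) ≤ ⟦ m ⟧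
    ⟦⟧*[*1/4]^≤⟦⟧⇐ n m k np^k≤m[4q]^k = ℚ.toℚᵘ-cancel-≤ (ℚᵘ.≤-respˡ-≃ (ℚᵘ.≃-sym toℚᵘ-lhs)
      (Represents-≤ {lhs} lhs≐ (Represents-⟦⟧ m) (subst₂ ℕ._≤_ numerator denominator np^k≤m[4q]^k)))
      where
      d/4 = toℚᵘ d ℚᵘ.* toℚᵘ (+ 1 / 4)
      lhs = toℚᵘ ⟦ n ⟧ ℚᵘ.* (d/4 ^ᵘ k)
      lhs≐ : Represents lhs (n ℕ.* (p ℕ.* 1) ℕ.^ k) (1 ℕ.* (q ℕ.* 4) ℕ.^ k)
      lhs≐ = Represents-* {toℚᵘ ⟦ n ⟧} (Represents-⟦⟧ n)
               (Represents-^ {d/4} (Represents-* {toℚᵘ d} d≐p/q (represents refl refl)) k)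
      numerator : n ℕ.* p ℕ.^ k ≡ n ℕ.* (p ℕ.* 1) ℕ.^ k ℕ.* 1
      numerator = sym (trans (ℕ.*-identityʳ _) (cong (λ x → n ℕ.* x ℕ.^ k) (ℕ.*-identityʳ p)))
      denominator : m ℕ.* (q ℕ.* 4) ℕ.^ k ≡ m ℕ.* (1 ℕ.* (q ℕ.* 4) ℕ.^ k)
      denominator = cong (m ℕ.*_) (sym (ℕ.*-identityˡ _))
      toℚᵘ-lhs : toℚᵘ (⟦ n ⟧ * ((d * (+ 1 / 4)) ^ℚ k)) ℚᵘ.≃ lhs
      toℚᵘ-lhs = ℚᵘ.≃-trans (ℚ.toℚᵘ-homo-* ⟦ n ⟧ _)
        (ℚᵘ.*-congˡ {toℚᵘ ⟦ n ⟧}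
          (ℚᵘ.≃-trans (toℚᵘ-^ℚ (d * (+ 1 / 4)) k) (^ᵘ-cong (ℚ.toℚᵘ-homo-* d (+ 1 / 4)) k)))

  ⟦⟧≮negative*1/8 : ∀ k p q′ .(c : Coprime.Coprime (suc p) (suc q′)) → ¬ ⟦ k ⟧ < mkℚ -[1+ p ] q′ c * (+ 1 / 8)
  ⟦⟧≮negative*1/8 k p q′ c k<d/8 with subst (ℤ._< -[1+ p ℕ.* 1 ℕ.* 1 ]) (sym (ℤ.pos-* k (suc q′ ℕ.* 8)))
    (ℚᵘ.drop-*<* (ℚᵘ.<-respʳ-≃ (ℚ.toℚᵘ-homo-* (mkℚ -[1+ p ] q′ c) (+ 1 / 8))
      (subst (ℚᵘ._< _) (toℚᵘ-⟦⟧ k) (ℚ.toℚᵘ-mono-< k<d/8))))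
  ... | ()

open import Data.Nat using (ℕ)
open import Data.Integer using (+_)
open import Data.Rational using (ℚ; _*_; _/_; _≤_; _<_)

open import Data.Nat using (suc)
open import Data.Integer using (-[1+_])
open import Data.Rational using (mkℚ; toℚᵘ)
open import Data.Empty using (⊥-elim)
open import Relation.Binary.PropositionalEquality using (refl)
open Counting using (rainbowPathCount-cleared)
open Rationals

lemma3p7 : ∀ {n : ℕ} (G : Graph n) (c : EdgeColouring G) (d : ℚ) (k : ℕ) →
    SymmetricColouring G c → Proper G c →
    ⟦ n ⟧ * d ≤ ⟦ edgeCount G ⟧ →
    1 Data.Nat.≤ k → ⟦ k ⟧ < d * (+ 1 / 8) →
    ⟦ n ⟧ * ((d * (+ 1 / 4)) ^ℚ k) ≤ ⟦ rainbowPathCount G c k ⟧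
lemma3p7 G c (mkℚ -[1+ p ] q′ cop) k _ _ _ _ k<d/8 = ⊥-elim (⟦⟧≮negative*1/8 k p q′ cop k<d/8)
lemma3p7 {n} G c d@(mkℚ (+ p) q′ _) (suc m) symmetric proper nd≤e _ k<d/8 =
  ⟦⟧*[*1/4]^≤⟦⟧⇐ d d≐p/q n (rainbowPathCount G c (suc m)) (suc m)
    (rainbowPathCount-cleared G c symmetric proper p (suc q′) m
      (⟦⟧*≤⟦⟧⇒ d d≐p/q n (edgeCount G) nd≤e) (⟦⟧<*1/8⇒ d d≐p/q (suc m) k<d/8))
  where
  d≐p/q : Represents (toℚᵘ d) p (suc q′)
  d≐p/q = represents refl refl
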